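{- Let $a,b,c,d$ be positive integers with $b>1$, $d>1$ and $N=a(b-1)=c(d-1)$. Let $r_1,\dots,r_N$ be the $N$ distinct residues modulo $ab$ (taken in $\{1,\dots,ab-1\}$) which are not $\equiv 0 \pmod b$, and let $s_1,\dots,s_N$ be the $N$ distinct residues modulo $cd$ (taken in $\{1,\dots,cd-1\}$) which are not $\equiv 0\pmod d$, each listed in some fixed order. Define $f:\mathbb{N}_0\to\mathbb{N}_0$ by $f(bn)=dn$ and $f(abn+r_i)=cdn+s_i$ for $i=1,\dots,N$ and all $n\in\mathbb{N}_0$. Then $f$ is a bijection of $\mathbb{N}_0$.
   Context: $\mathbb{N}_0=\{0,1,2,\dots\}$. -}

module Defs where

open import Data.Nat using (ℕ; _<_; _≤_)
open import Data.Nat.Divisibility using (_∣_)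
open import Data.Fin using (Fin)
open import Data.Product using (_×_; ∃)
open import Relation.Nullary using (¬_)
open import Relation.Binary.PropositionalEquality using (_≡_)
open import Function.Definitions using (Injective)

-- r lists, without repetition, exactly the residues x ∈ {1,…,m-1} with x ≢ 0 (mod b)
-- (here m = ab resp. cd); "listed in some fixed order" = an arbitrary such listing.
ListsNonMultipleResidues : (m b N : ℕ) → (Fin N → ℕ) → Set
ListsNonMultipleResidues m b N r =
  Injective _≡_ _≡_ r
  × (∀ i → (1 ≤ r i) × (r i < m) × ¬ (b ∣ r i))
  × (∀ x → 1 ≤ x → x < m → ¬ (b ∣ x) → ∃ λ i → r i ≡ x)

-- Every x ∈ ℕ is uniquely either a multiple b n or of the form a b n + rᵢ, and every
-- y is uniquely either d n or c d n + sᵢ; f sends the first kind to the first kind and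
-- the second to the second with the same n and i. The two kinds never overlap, since
-- b ∣ a b but b ∤ rᵢ, so f is a bijection by uniqueness of division with remainder.
module Submission where

open import Defs
open import Data.Nat using (ℕ; _+_; _*_; _∸_; _<_; _≤_)
open import Data.Fin using (Fin)
open import Relation.Binary.PropositionalEquality using (_≡_)
open import Function.Definitions using (Bijective; Injective; Surjective)

open import Data.Nat.Base using (zero; suc; NonZero; >-nonZero; _%_; _/_; z≤n; s≤s)
open import Data.Nat.Properties using (+-comm; +-cancelʳ-≡; *-comm; *-cancelˡ-≡; *-mono-≤; <⇒≤)
open import Data.Nat.Divisibility using (_∣_; divides; _∣?_; _∣0; ∣-trans; m∣m*n; n∣m*n; ∣m∣n⇒∣m+n; ∣m+n∣m⇒∣n)
open import Data.Nat.DivMod using (m≡m%n+[m/n]*n; m%n<n; m<n⇒m%n≡m; [m+kn]%n≡m%n)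
open import Data.Product using (_×_; _,_; ∃; proj₁; proj₂)
open import Data.Empty using (⊥-elim)
open import Relation.Nullary using (¬_; yes; no)
open import Relation.Binary.PropositionalEquality using (_≢_; refl; sym; trans; cong; subst; module ≡-Reasoning)

open ≡-Reasoning

module _ {K : ℕ} .{{_ : NonZero K}} where

  [K*n+s]%K≡s : ∀ n {s} → s < K → (K * n + s) % K ≡ s
  [K*n+s]%K≡s n {s} s<K = begin
    (K * n + s) % K ≡⟨ cong (_% K) (trans (+-comm (K * n) s) (cong (s +_) (*-comm K n))) ⟩
    (s + n * K) % K ≡⟨ [m+kn]%n≡m%n s n K ⟩
    s % K           ≡⟨ m<n⇒m%n≡m s<K ⟩
    s               ∎

  divMod-unique : ∀ n m {s t} → s < K → t < K → K * n + s ≡ K * m + t → n ≡ m × s ≡ t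
  divMod-unique n m {s} {t} s<K t<K eq = *-cancelˡ-≡ n m K Kn≡Km , s≡t
    where
    s≡t : s ≡ t
    s≡t = trans (sym ([K*n+s]%K≡s n s<K)) (trans (cong (_% K) eq) ([K*n+s]%K≡s m t<K))
    Kn≡Km : K * n ≡ K * m
    Kn≡Km = +-cancelʳ-≡ t (K * n) (K * m) (trans (cong (K * n +_) (sym s≡t)) eq)

data MultipleOrResidue (b K : ℕ) {N : ℕ} (r : Fin N → ℕ) : ℕ → Set where
  multiple : ∀ n → MultipleOrResidue b K r (b * n)
  residue  : ∀ i n → MultipleOrResidue b K r (K * n + r i)

multipleOrResidue : ∀ {b K N} {r : Fin N → ℕ} .{{_ : NonZero K}} → b ∣ K →
                    ListsNonMultipleResidues K b N r → ∀ x → MultipleOrResidue b K r x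
multipleOrResidue {b} {K} {r = r} b∣K (_ , _ , covers) x with b ∣? x
... | yes (divides q x≡q*b) = subst (MultipleOrResidue b K r) (sym (trans x≡q*b (*-comm q b))) (multiple q)
... | no b∤x = fromCover (covers (x % K) 1≤x%K (m%n<n x K) b∤x%K)
  where
  x≡x%K+K*[x/K] : x ≡ x % K + K * (x / K)
  x≡x%K+K*[x/K] = trans (m≡m%n+[m/n]*n x K) (cong (x % K +_) (*-comm (x / K) K))
  b∤x%K : ¬ (b ∣ x % K)
  b∤x%K b∣x%K = b∤x (subst (b ∣_) (sym x≡x%K+K*[x/K]) (∣m∣n⇒∣m+n b∣x%K (∣-trans b∣K (m∣m*n (x / K)))))
  1≤x%K : 1 ≤ x % K
  1≤x%K with x % K | b∤x%K
  ... | zero  | b∤0 = ⊥-elim (b∤0 (b ∣0))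
  ... | suc _ | _   = s≤s z≤n
  fromCover : ∃ (λ i → r i ≡ x % K) → MultipleOrResidue b K r x
  fromCover (i , ri≡x%K) = subst (MultipleOrResidue b K r) K*[x/K]+ri≡x (residue i (x / K))
    where
    K*[x/K]+ri≡x : K * (x / K) + r i ≡ x
    K*[x/K]+ri≡x = begin
      K * (x / K) + r i   ≡⟨ cong (K * (x / K) +_) ri≡x%K ⟩
      K * (x / K) + x % K ≡⟨ +-comm (K * (x / K)) (x % K) ⟩
      x % K + K * (x / K) ≡⟨ sym x≡x%K+K*[x/K] ⟩
      x                   ∎

multiple≢residue : ∀ {b K} n m {t} → b ∣ K → ¬ (b ∣ t) → b * n ≢ K * m + t
multiple≢residue {b} n m b∣K b∤t eq = b∤t (∣m+n∣m⇒∣n (subst (b ∣_) eq (m∣m*n n)) (∣-trans b∣K (m∣m*n m)))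

module _ {b K d L N : ℕ} .{{_ : NonZero K}} .{{_ : NonZero L}} .{{_ : NonZero d}}
         {r s : Fin N → ℕ} (b∣K : b ∣ K) (d∣L : d ∣ L)
         (r-lists : ListsNonMultipleResidues K b N r) (s-lists : ListsNonMultipleResidues L d N s)
         {f : ℕ → ℕ} (f-multiple : ∀ n → f (b * n) ≡ d * n)
         (f-residue : ∀ i n → f (K * n + r i) ≡ L * n + s i) where

  private
    s-injective : Injective _≡_ _≡_ s
    s-injective = proj₁ s-lists
    s<L : ∀ i → s i < L
    s<L i = proj₁ (proj₂ (proj₁ (proj₂ s-lists) i))
    d∤s : ∀ i → ¬ (d ∣ s i)
    d∤s i = proj₂ (proj₂ (proj₁ (proj₂ s-lists) i))

  multipleOrResidue-map-injective : Injective _≡_ _≡_ f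
  multipleOrResidue-map-injective {x} {y} fx≡fy
    with multipleOrResidue b∣K r-lists x | multipleOrResidue b∣K r-lists y
  ... | multiple n | multiple m =
    cong (b *_) (*-cancelˡ-≡ n m d (trans (sym (f-multiple n)) (trans fx≡fy (f-multiple m))))
  ... | multiple n | residue j m =
    ⊥-elim (multiple≢residue n m d∣L (d∤s j) (trans (sym (f-multiple n)) (trans fx≡fy (f-residue j m))))
  ... | residue i n | multiple m =
    ⊥-elim (multiple≢residue m n d∣L (d∤s i) (trans (sym (f-multiple m)) (trans (sym fx≡fy) (f-residue i n))))
  ... | residue i n | residue j m
    with divMod-unique n m (s<L i) (s<L j) (trans (sym (f-residue i n)) (trans fx≡fy (f-residue j m)))
  ... | refl , si≡sj with s-injective si≡sj
  ... | refl = refl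

  multipleOrResidue-map-surjective : Surjective _≡_ _≡_ f
  multipleOrResidue-map-surjective y with multipleOrResidue d∣L s-lists y
  ... | multiple n  = b * n , λ { refl → f-multiple n }
  ... | residue i n = K * n + r i , λ { refl → f-residue i n }

lemma1 : (a b c d N : ℕ) → 1 ≤ a → 1 < b → 1 ≤ c → 1 < d →
         N ≡ a * (b ∸ 1) → N ≡ c * (d ∸ 1) →
         (r s : Fin N → ℕ) →
         ListsNonMultipleResidues (a * b) b N r →
         ListsNonMultipleResidues (c * d) d N s →
         (f : ℕ → ℕ) →
         (∀ n → f (b * n) ≡ d * n) →
         (∀ (i : Fin N) n → f (a * b * n + r i) ≡ c * d * n + s i) →
         Bijective _≡_ _≡_ f
lemma1 a b c d N 1≤a 1<b 1≤c 1<d _ _ r s r-lists s-lists f f-multiple f-residue =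
  multipleOrResidue-map-injective (n∣m*n a) (n∣m*n c) r-lists s-lists f-multiple f-residue ,
  multipleOrResidue-map-surjective (n∣m*n a) (n∣m*n c) r-lists s-lists f-multiple f-residue
  where
  instance
    ab≢0 : NonZero (a * b)
    ab≢0 = >-nonZero (*-mono-≤ 1≤a (<⇒≤ 1<b))
    cd≢0 : NonZero (c * d)
    cd≢0 = >-nonZero (*-mono-≤ 1≤c (<⇒≤ 1<d))
    d≢0 : NonZero d
    d≢0 = >-nonZero (<⇒≤ 1<d)
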